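{- Let $P$ be a closed classical type, $Q$ a qubit pointer context and $v$ a value such that the judgement $Q \vdash v : P$ is derivable. Then $Q = \varnothing$.
   Context: Types are generated by the grammar $A, B ::= X \mid I \mid \mathbf{qbit} \mid A + B \mid A \otimes B \mid \mu X. A$, where $X$ ranges over type variables. A type context $\Theta$ is a finite list of distinct type variables, and $\Theta \vdash A$ (well-formedness) is derivable by: $\Theta \vdash X$ if $X$ occurs in $\Theta$; $\Theta \vdash I$; $\Theta \vdash \mathbf{qbit}$; if $\Theta \vdash A$ and $\Theta \vdash B$ then $\Theta \vdash A+B$ and $\Theta \vdash A \otimes B$; if $\Theta, X \vdash A$ then $\Theta \vdash \mu X.A$. A type $A$ is closed if $\cdot \vdash A$ (empty type context). Classical types are the types generated by the grammar $P, R ::= X \mid I \mid P + R \mid P \otimes R \mid \mu X. P$ (i.e. types not containing $\mathbf{qbit}$). $A[B/X]$ denotes substitution of $B$ for $X$ in $A$. Values are expressions $v, w ::= * \mid n \mid \mathbf{left}_{A,B}\, v \mid \mathbf{right}_{A,B}\, v \mid (v,w) \mid \mathbf{fold}_{\mu X.A}\, v$ with $n \in \mathbb{N}$. A qubit pointer context is a finite set $Q \subseteq \mathbb{N}$. The judgement $Q \vdash v : A$ (with $A$ closed) is derivable by the rules: $\varnothing \vdash * : I$; $\{n\} \vdash n : \mathbf{qbit}$; if $Q \vdash v : A$ then $Q \vdash \mathbf{left}_{A,B}\, v : A+B$; if $Q \vdash v : B$ then $Q \vdash \mathbf{right}_{A,B}\, v : A+B$; if $Q_1 \vdash v : A$,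 $Q_2 \vdash w : B$ and $Q_1 \cap Q_2 = \varnothing$ then $Q_1 \cup Q_2 \vdash (v,w) : A \otimes B$; if $Q \vdash v : A[\mu X.A/X]$ then $Q \vdash \mathbf{fold}_{\mu X.A}\, v : \mu X.A$. -}

module Defs where

open import Data.Nat using (ℕ)
open import Data.Nat.Properties using (_≟_)
open import Data.List using (List; []; _∷_; [_]; _++_)
open import Data.List.Membership.Propositional using (_∈_)
open import Data.List.Relation.Binary.Disjoint.Propositional using (Disjoint)
open import Relation.Nullary using (yes; no)

TVar : Set
TVar = ℕ

data Ty : Set where
  var  : TVar → Ty
  I    : Ty
  qbit : Ty
  _⊕_  : Ty → Ty → Ty
  _⊗_  : Ty → Ty → Ty
  μ    : TVar → Ty → Ty

TCtx : Set
TCtx = List TVar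

data _⊢ty_ (Θ : TCtx) : Ty → Set where
  wf-var  : ∀ {X} → X ∈ Θ → Θ ⊢ty var X
  wf-I    : Θ ⊢ty I
  wf-qbit : Θ ⊢ty qbit
  wf-⊕    : ∀ {A B} → Θ ⊢ty A → Θ ⊢ty B → Θ ⊢ty (A ⊕ B)
  wf-⊗    : ∀ {A B} → Θ ⊢ty A → Θ ⊢ty B → Θ ⊢ty (A ⊗ B)
  wf-μ    : ∀ {X A} → (X ∷ Θ) ⊢ty A → Θ ⊢ty μ X A

Closed : Ty → Set
Closed A = [] ⊢ty A

data Classical : Ty → Set where
  cl-var : ∀ {X} → Classical (var X)
  cl-I   : Classical I
  cl-⊕   : ∀ {P R} → Classical P → Classical R → Classical (P ⊕ R)
  cl-⊗   : ∀ {P R} → Classical P → Classical R → Classical (P ⊗ R)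
  cl-μ   : ∀ {X P} → Classical P → Classical (μ X P)

-- Substitution A[B/X] (stops at a rebinding of X; only used with closed B,
-- so no capture can occur).
_[_/_] : Ty → Ty → TVar → Ty
var Y   [ B / X ] with Y ≟ X
... | yes _ = B
... | no _  = var Y
I       [ B / X ] = I
qbit    [ B / X ] = qbit
(A ⊕ C) [ B / X ] = (A [ B / X ]) ⊕ (C [ B / X ])
(A ⊗ C) [ B / X ] = (A [ B / X ]) ⊗ (C [ B / X ])
μ Y A   [ B / X ] with Y ≟ X
... | yes _ = μ Y A
... | no _  = μ Y (A [ B / X ])

data Val : Set where
  ⋆     : Val
  ptr   : ℕ → Val
  left  : Ty → Ty → Val → Val
  right : Ty → Ty → Val → Val
  pair  : Val → Val → Val
  fold  : Ty → Val → Val   -- fold_{μX.A}: the Ty annotation is μX.A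

-- Qubit pointer contexts: finite sets of naturals, represented by lists;
-- union of disjoint sets is concatenation, ∅ is [].
QCtx : Set
QCtx = List ℕ

data _⊢v_∶_ : QCtx → Val → Ty → Set where
  t-unit  : [] ⊢v ⋆ ∶ I
  t-qbit  : ∀ {n} → [ n ] ⊢v ptr n ∶ qbit
  t-left  : ∀ {Q v A B} → Q ⊢v v ∶ A → Q ⊢v left A B v ∶ (A ⊕ B)
  t-right : ∀ {Q v A B} → Q ⊢v v ∶ B → Q ⊢v right A B v ∶ (A ⊕ B)
  t-pair  : ∀ {Q₁ Q₂ v w A B} → Q₁ ⊢v v ∶ A → Q₂ ⊢v w ∶ B →
            Disjoint Q₁ Q₂ → (Q₁ ++ Q₂) ⊢v pair v w ∶ (A ⊗ B)
  t-fold  : ∀ {Q v X A} → Q ⊢v v ∶ (A [ μ X A / X ]) →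
            Q ⊢v fold (μ X A) v ∶ μ X A

module Submission where

-- A classical type contains no occurrence of qbit, and qbit is the only type
-- whose values (the pointers n) own a qubit.  The proof is an induction on the
-- typing derivation Q ⊢ v : P, strengthened to arbitrary (not necessarily
-- closed) classical types P:
--   * unit and qubit pointers are base cases (the latter cannot occur, since
--     qbit is not classical);
--   * injections and pairs follow from the induction hypotheses, since the
--     context of a pair is the union of the contexts of its components;
--   * for fold_{μX.A} v the premise types v at A[μX.A/X], which is again
--     classical because classical types are closed under substitution.

open import Defs
open import Data.List using ([]; _++_)
open import Relation.Binary.PropositionalEquality using (_≡_; refl; cong₂)
open import Data.Nat.Properties using (_≟_)
open import Relation.Nullary using (yes; no)

classical-subst : ∀ {A B} X → Classical A → Classical B → Classical (A [ B / X ])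
classical-subst {var Y}   X cl-var       cB with Y ≟ X
... | yes _ = cB
... | no _  = cl-var
classical-subst {I}       X cl-I         cB = cl-I
classical-subst {A ⊕ C}   X (cl-⊕ cA cC) cB =
  cl-⊕ (classical-subst X cA cB) (classical-subst X cC cB)
classical-subst {A ⊗ C}   X (cl-⊗ cA cC) cB =
  cl-⊗ (classical-subst X cA cB) (classical-subst X cC cB)
classical-subst {μ Y A}   X (cl-μ cA)    cB with Y ≟ X
... | yes _ = cl-μ cA
... | no _  = cl-μ (classical-subst X cA cB)

classical-value-no-qubits : ∀ {Q v P} → Classical P → Q ⊢v v ∶ P → Q ≡ []
classical-value-no-qubits cl-I         t-unit        = refl
classical-value-no-qubits (cl-⊕ cA _)  (t-left  ⊢v)  = classical-value-no-qubits cA ⊢v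
classical-value-no-qubits (cl-⊕ _ cB)  (t-right ⊢v)  = classical-value-no-qubits cB ⊢v
classical-value-no-qubits (cl-⊗ cA cB) (t-pair ⊢v ⊢w _) =
  cong₂ _++_ (classical-value-no-qubits cA ⊢v) (classical-value-no-qubits cB ⊢w)
classical-value-no-qubits (cl-μ cA)    (t-fold {X = X} ⊢v) =
  classical-value-no-qubits (classical-subst X cA (cl-μ cA)) ⊢v

lemma1 : (P : Ty) (Q : QCtx) (v : Val) →
    Closed P → Classical P → Q ⊢v v ∶ P → Q ≡ []
lemma1 P Q v _ classical ⊢v = classical-value-no-qubits classical ⊢v
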